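{- Let $t$ be an arbor on a finite set $I$. Every vertex of the polytope $Q_t$ belongs to the Minkowski sum $\mathbb{M}_t=\sum_v U_v$ (sum over all vertices $v$ of $t$).
   Context: An arbor on a finite non-empty set $I$ is a rooted tree whose vertices are labeled by pairwise disjoint non-empty subsets of $I$ whose union is $I$; we identify a vertex with its label set and write $|v|$ for its cardinality. For a vertex $v$, $\mathscr{D}(v)\subseteq I$ is the union of the labels of all vertices $w$ whose path to the root passes through $v$ (including $v$), and $\mathscr{U}(v)\subseteq I$ is the union of the labels of all vertices on the path from the root to $v$ (both included). The polytope $Q_t\subset \mathbb{R}^I$ is defined by $x_i\ge 0$ for all $i\in I$ and $\sum_{i\in\mathscr{D}(v)}x_i\le|\mathscr{D}(v)|$ for every vertex $v$. For a vertex $v$, $U_v\subset\mathbb{R}^I$ is the convex hull of the origin and the points $|v|e_i$ for $i\in\mathscr{U}(v)$, where $(e_i)_{i\in I}$ is the standard basis.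
   Formalization: Points of $Q_t$, $U_v$ and $\mathbb{M}_t$, including those in the vertex test, have rational coordinates in place of real ones, and convex weights and combination coefficients are rational. -}

module Defs where

open import Data.Nat using (ℕ)
open import Data.Fin using (Fin; _≟_)
open import Data.List using (List; []; _∷_; _++_; map; foldr; length; zipWith; allFin)
open import Data.List.Relation.Unary.All using (All)
open import Data.List.Relation.Binary.Permutation.Propositional using (_↭_)
open import Data.Product using (Σ; _×_; _,_)
open import Data.Rational using (ℚ; 0ℚ; 1ℚ; _+_; _*_; _-_; _≤_; _<_; _/_)
open import Data.Integer using (+_)
open import Relation.Nullary using (yes; no)
open import Relation.Binary.PropositionalEquality using (_≡_; _≢_)

-- Points of ℚ^I, where the finite ground set I is Fin n.

Pt : ℕ → Set
Pt n = Fin n → ℚ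

ℕtoℚ : ℕ → ℚ
ℕtoℚ k = (+ k) / 1

sumℚ : List ℚ → ℚ
sumℚ = foldr _+_ 0ℚ

e : ∀ {n} → Fin n → Pt n
e i j with i ≟ j
... | yes _ = 1ℚ
... | no  _ = 0ℚ

scale : ∀ {n} → ℚ → Pt n → Pt n
scale c p j = c * p j

origin : ∀ {n} → Pt n
origin _ = 0ℚ

-- Arbors on Fin n: rooted (rose) trees whose vertices carry label lists.
-- A vertex's label set is given as a list of elements of Fin n.

data Arbor (n : ℕ) : Set where
  node : List (Fin n) → List (Arbor n) → Arbor n

mutual
  flat : ∀ {n} → Arbor n → List (Fin n)
  flat (node l ts) = l ++ flatF ts

  flatF : ∀ {n} → List (Arbor n) → List (Fin n)
  flatF [] = []
  flatF (t ∷ ts) = flat t ++ flatF ts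

-- Data attached to a vertex v: its label v, 𝒟(v), 𝒰(v).
record VInfo (n : ℕ) : Set where
  constructor vinfo
  field
    lab : List (Fin n)
    down : List (Fin n)
    up : List (Fin n)

-- all vertices of a tree; the first argument is the union of the labels of
-- the strict ancestors of the current root.
mutual
  verts : ∀ {n} → List (Fin n) → Arbor n → List (VInfo n)
  verts anc (node l ts) = vinfo l (l ++ flatF ts) (anc ++ l) ∷ vertsF (anc ++ l) ts

  vertsF : ∀ {n} → List (Fin n) → List (Arbor n) → List (VInfo n)
  vertsF anc [] = []
  vertsF anc (t ∷ ts) = verts anc t ++ vertsF anc ts

vertices : ∀ {n} → Arbor n → List (VInfo n)
vertices = verts []

-- t is an arbor on Fin n: labels are non-empty, pairwise disjoint,
-- duplicate-free and their union is all of Fin n (i.e. the concatenation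
-- of all labels is a permutation of the list of all elements of Fin n).
IsArbor : ∀ {n} → Arbor n → Set
IsArbor {n} t = (flat t ↭ allFin n) × All (λ v → VInfo.lab v ≢ []) (vertices t)

InQ : ∀ {n} → Arbor n → Pt n → Set
InQ t x = (∀ i → 0ℚ ≤ x i)
        × All (λ v → sumℚ (map x (VInfo.down v)) ≤ ℕtoℚ (length (VInfo.down v))) (vertices t)

IsVertexQ : ∀ {n} → Arbor n → Pt n → Set
IsVertexQ {n} t x = InQ t x ×
  ((a b : Pt n) (λ' : ℚ) → InQ t a → InQ t b → 0ℚ < λ' → λ' < 1ℚ →
   (∀ i → x i ≡ λ' * a i + (1ℚ - λ') * b i) → ∀ i → a i ≡ b i)

InHull : ∀ {n} → List (Pt n) → Pt n → Set
InHull ps y = Σ (List ℚ) λ ws →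
    (length ws ≡ length ps) × All (λ w → 0ℚ ≤ w) ws × (sumℚ ws ≡ 1ℚ)
  × (∀ j → y j ≡ sumℚ (zipWith (λ w p → w * p j) ws ps))

InU : ∀ {n} → VInfo n → Pt n → Set
InU v = InHull (origin ∷ map (λ i → scale (ℕtoℚ (length (VInfo.lab v))) (e i)) (VInfo.up v))

InMinkowski : ∀ {n} → List (Pt n → Set) → Pt n → Set
InMinkowski [] x = ∀ i → x i ≡ 0ℚ
InMinkowski {n} (S ∷ Ss) x = Σ (Pt n) λ y → Σ (Pt n) λ z →
  S y × InMinkowski Ss z × (∀ i → x i ≡ y i + z i)

InM : ∀ {n} → Arbor n → Pt n → Set
InM t = InMinkowski (map InU (vertices t))

-- All of Q_t, not only its vertices, lies in 𝕄_t. A point x ∈ Q_t is handed out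
-- to the vertices from the root downwards. What is left for a subtree s whose
-- strict ancestors carry the labels A is nonnegative, supported on A ∪ 𝒟(s),
-- satisfies the constraints of the vertices of s, and has total mass at most
-- |𝒟(s)|. Since U_v is the set of y ≥ 0 supported on 𝒰(v) with Σ y ≤ |v|, the
-- root v of s takes as large a fraction φ of what is left on 𝒰(v) = A ∪ v as
-- fits; the rest is then of the same kind for the forest of children of v. In a
-- forest, the mass on A is split between the first tree and the others so that
-- each part receives at most its slack |𝒟| − Σ_𝒟 x: the slacks are nonnegative
-- by the root constraints and cover the mass on A by the mass bound.

{-# OPTIONS --safe #-}
module Submission where

open import Defs
open import Data.Nat using (ℕ; suc)
import Data.Nat as ℕ
open import Data.Fin using (Fin; _≟_)
import Data.Integer as ℤ
import Data.Integer.Properties as ℤ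
import Data.Nat.Coprimality as Coprime
open import Data.Rational
  using (ℚ; 0ℚ; 1ℚ; _+_; _*_; _-_; -_; _≤_; _<_; mkℚ; 1/_; toℚᵘ; positive; nonNegative)
open import Data.Rational.Properties hiding (_≟_)
import Data.Rational.Unnormalised as ℚᵘ
import Data.Rational.Unnormalised.Properties as ℚᵘ
open import Data.Rational.Solver using (module +-*-Solver)
open import Data.List using (List; []; _∷_; _++_; map; length; zipWith)
open import Data.List.Properties using (++-assoc; length-++; length-map; map-++)
open import Data.List.Membership.Propositional using (_∈_; _∉_)
open import Data.List.Membership.Propositional.Properties using (∈-++⁺ˡ; ∈-++⁺ʳ; ∈-++⁻; ∈-allFin)
open import Data.List.Relation.Unary.All as All using (All; []; _∷_)
import Data.List.Relation.Unary.All.Properties as All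
open import Data.List.Relation.Unary.Any using (here; there)
open import Data.List.Relation.Unary.AllPairs using ([]; _∷_)
open import Data.List.Relation.Unary.Unique.Propositional using (Unique)
import Data.List.Relation.Unary.Unique.Propositional.Properties as Unique
open import Data.List.Relation.Binary.Disjoint.Propositional using (Disjoint)
open import Data.List.Relation.Binary.Subset.Propositional using (_⊆_)
open import Data.List.Relation.Binary.Subset.Propositional.Properties
  using (⊆-refl; ⊆-trans; xs⊆xs++ys; xs⊆ys++xs)
open import Data.List.Relation.Binary.Permutation.Propositional using (↭-sym; ↭⇒↭ₛ)
open import Data.List.Relation.Binary.Permutation.Propositional.Properties using (∈-resp-↭)
import Data.List.Relation.Binary.Permutation.Setoid.Properties as Permutation
open import Data.Product using (Σ; _×_; _,_)
open import Data.Sum using ([_,_]′)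
open import Function using (_∘_)
open import Relation.Nullary using (yes; no; contradiction)
open import Relation.Binary.PropositionalEquality
  using (_≡_; _≢_; refl; sym; trans; cong; cong₂; subst; setoid; module ≡-Reasoning)

open +-*-Solver using (solve; _:+_; _:*_; _:-_; _:=_; con)

*-nonneg : ∀ {p q} → 0ℚ ≤ p → 0ℚ ≤ q → 0ℚ ≤ p * q
*-nonneg {p} 0≤p 0≤q =
  ≤-trans (≤-reflexive (sym (*-zeroʳ p))) (*-monoˡ-≤-nonNeg p {{nonNegative 0≤p}} 0≤q)

0≤q-p : ∀ {p q} → p ≤ q → 0ℚ ≤ q - p
0≤q-p {p} p≤q = ≤-trans (≤-reflexive (sym (+-inverseʳ p))) (+-monoˡ-≤ (- p) p≤q)

ℕtoℚ≡mkℚ : ∀ k → ℕtoℚ k ≡ mkℚ (ℤ.+ k) 0 (Coprime.sym (Coprime.1-coprimeTo k))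
ℕtoℚ≡mkℚ k = normalize-coprime (Coprime.sym (Coprime.1-coprimeTo k))

ℕtoℚ-+ : ∀ a b → ℕtoℚ (a ℕ.+ b) ≡ ℕtoℚ a + ℕtoℚ b
ℕtoℚ-+ a b = toℚᵘ-injective (ℚᵘ.≃-trans unnormalised (ℚᵘ.≃-sym (toℚᵘ-homo-+ (ℕtoℚ a) (ℕtoℚ b))))
  where
  unnormalised : toℚᵘ (ℕtoℚ (a ℕ.+ b)) ℚᵘ.≃ toℚᵘ (ℕtoℚ a) ℚᵘ.+ toℚᵘ (ℕtoℚ b)
  unnormalised rewrite ℕtoℚ≡mkℚ (a ℕ.+ b) | ℕtoℚ≡mkℚ a | ℕtoℚ≡mkℚ b =
    ℚᵘ.*≡* (denominators-one {ℤ.+ a} {ℤ.+ b} (ℤ.pos-+ a b))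
    where
    denominators-one : ∀ {x y z} → z ≡ x ℤ.+ y → z ℤ.* ℤ.1ℤ ≡ (x ℤ.* ℤ.1ℤ ℤ.+ y ℤ.* ℤ.1ℤ) ℤ.* ℤ.1ℤ
    denominators-one {x} {y} {z} z≡x+y
      rewrite ℤ.*-identityʳ z | ℤ.*-identityʳ x | ℤ.*-identityʳ y | ℤ.*-identityʳ (x ℤ.+ y) = z≡x+y

ℕtoℚ-length-++ : ∀ {A : Set} (xs ys : List A) →
  ℕtoℚ (length (xs ++ ys)) ≡ ℕtoℚ (length xs) + ℕtoℚ (length ys)
ℕtoℚ-length-++ xs ys = trans (cong ℕtoℚ (length-++ xs)) (ℕtoℚ-+ (length xs) (length ys))

0≤ℕtoℚ : ∀ k → 0ℚ ≤ ℕtoℚ k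
0≤ℕtoℚ k rewrite ℕtoℚ≡mkℚ k = nonNegative⁻¹ _

0<ℕtoℚ-length : ∀ {A : Set} {xs : List A} → xs ≢ [] → 0ℚ < ℕtoℚ (length xs)
0<ℕtoℚ-length {xs = []}     []≢[] = contradiction refl []≢[]
0<ℕtoℚ-length {xs = x ∷ xs} _     rewrite ℕtoℚ≡mkℚ (suc (length xs)) = positive⁻¹ _

record MassSplit (M u v a b : ℚ) : Set where
  field
    φ           : ℚ
    0≤φ         : 0ℚ ≤ φ
    φ≤1         : φ ≤ 1ℚ
    first-fits  : φ * M + u ≤ a
    second-fits : (1ℚ - φ) * M + v ≤ b

split-mass : ∀ {M u v a b} → u ≤ a → v ≤ b → M + (u + v) ≤ a + b → MassSplit M u v a b
split-mass {M} {u} {v} {a} {b} u≤a v≤b total with M + u ≤? a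
... | yes M+u≤a = record
  { φ           = 1ℚ
  ; 0≤φ         = <⇒≤ (positive⁻¹ 1ℚ)
  ; φ≤1         = ≤-refl
  ; first-fits  = ≤-trans (≤-reflexive (cong (_+ u) (*-identityˡ M))) M+u≤a
  ; second-fits =
      ≤-trans (≤-reflexive (solve 2 (λ M v → (con 1ℚ :- con 1ℚ) :* M :+ v := v) refl M v)) v≤b
  }
... | no M+u≰a = record
  { φ = φ ; 0≤φ = 0≤φ ; φ≤1 = φ≤1 ; first-fits = ≤-reflexive φM+u≡a ; second-fits = rest≤b }
  where
  open ≤-Reasoning
  a-u<M : a - u < M
  a-u<M = <-≤-trans (+-monoˡ-< (- u) (≰⇒> M+u≰a))
                    (≤-reflexive (solve 2 (λ M u → M :+ u :- u := M) refl M u))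
  instance
    M-pos = positive (≤-<-trans (0≤q-p u≤a) a-u<M)
    M≢0 = pos⇒nonZero M
  φ = (a - u) * 1/ M
  φM≡a-u : φ * M ≡ a - u
  φM≡a-u = trans (*-assoc (a - u) (1/ M) M)
                 (trans (cong ((a - u) *_) (*-inverseˡ M)) (*-identityʳ (a - u)))
  0≤φ : 0ℚ ≤ φ
  0≤φ = *-nonneg (0≤q-p u≤a) (<⇒≤ (positive⁻¹ (1/ M) {{1/pos⇒pos M}}))
  φ≤1 : φ ≤ 1ℚ
  φ≤1 = ≤-trans (*-monoʳ-≤-nonNeg (1/ M) {{pos⇒nonNeg (1/ M) {{1/pos⇒pos M}}}} (<⇒≤ a-u<M))
                (≤-reflexive (*-inverseʳ M))
  φM+u≡a : φ * M + u ≡ a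
  φM+u≡a = trans (cong (_+ u) φM≡a-u) (solve 2 (λ a u → a :- u :+ u := a) refl a u)
  rest≤b : (1ℚ - φ) * M + v ≤ b
  rest≤b = begin
    (1ℚ - φ) * M + v  ≡⟨ solve 3 (λ f M v → (con 1ℚ :- f) :* M :+ v := M :- f :* M :+ v) refl φ M v ⟩
    M - φ * M + v     ≡⟨ cong (λ x → M - x + v) φM≡a-u ⟩
    M - (a - u) + v   ≡⟨ solve 4 (λ M u v a → M :- (a :- u) :+ v := M :+ (u :+ v) :- a) refl M u v a ⟩
    M + (u + v) - a   ≤⟨ +-monoˡ-≤ (- a) total ⟩
    a + b - a         ≡⟨ solve 2 (λ a b → a :+ b :- a := b) refl a b ⟩
    b                 ∎

zipWith-map-diagonal : ∀ {A B C D : Set} (f : B → C → D) (g : A → B) (h : A → C) xs →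
  zipWith f (map g xs) (map h xs) ≡ map (λ x → f (g x) (h x)) xs
zipWith-map-diagonal f g h []       = refl
zipWith-map-diagonal f g h (x ∷ xs) = cong (f (g x) (h x) ∷_) (zipWith-map-diagonal f g h xs)

∉-++⁺ : ∀ {A : Set} {x : A} xs {ys} → x ∉ xs → x ∉ ys → x ∉ xs ++ ys
∉-++⁺ xs x∉xs x∉ys x∈ = [ x∉xs , x∉ys ]′ (∈-++⁻ xs x∈)

Unique-++⁻ : ∀ {A : Set} (xs : List A) {ys} → Unique (xs ++ ys) → Unique xs × Unique ys × Disjoint xs ys
Unique-++⁻ []       u = [] , u , λ ()
Unique-++⁻ (x ∷ xs) (x∉ ∷ u) with Unique-++⁻ xs u
... | uxs , uys , xs#ys =
  All.++⁻ˡ xs x∉ ∷ uxs , uys ,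
  λ { (here refl , y∈) → All.lookup (All.++⁻ʳ xs x∉) y∈ refl
    ; (there x∈ , y∈) → xs#ys (x∈ , y∈) }

Unique-++-++⁻ : ∀ {A : Set} (xs ys : List A) {zs} → Unique (xs ++ (ys ++ zs)) →
  Unique (xs ++ ys) × Unique (xs ++ zs)
Unique-++-++⁻ xs ys u with Unique-++⁻ xs u
... | uxs , uyzs , xs#yzs with Unique-++⁻ ys uyzs
...   | uys , uzs , _ =
  Unique.++⁺ uxs uys (λ (x∈ , y∈) → xs#yzs (x∈ , ∈-++⁺ˡ y∈)) ,
  Unique.++⁺ uxs uzs (λ (x∈ , z∈) → xs#yzs (x∈ , ∈-++⁺ʳ ys z∈))

InMinkowski-resp : ∀ {n} (Ss : List (Pt n → Set)) {a b : Pt n} →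
  (∀ i → a i ≡ b i) → InMinkowski Ss a → InMinkowski Ss b
InMinkowski-resp []       a≡b a≡0 i = trans (sym (a≡b i)) (a≡0 i)
InMinkowski-resp (S ∷ Ss) a≡b (y , z , y∈S , z∈Ss , a≡y+z) =
  y , z , y∈S , z∈Ss , λ i → trans (sym (a≡b i)) (a≡y+z i)

InMinkowski-++ : ∀ {n} (Ss Ts : List (Pt n → Set)) {a b x : Pt n} →
  InMinkowski Ss a → InMinkowski Ts b → (∀ i → x i ≡ a i + b i) → InMinkowski (Ss ++ Ts) x
InMinkowski-++ []       Ts a≡0 b∈Ts x≡a+b =
  InMinkowski-resp Ts (λ i → sym (trans (x≡a+b i) (trans (cong (_+ _) (a≡0 i)) (+-identityˡ _)))) b∈Ts
InMinkowski-++ (S ∷ Ss) Ts {b = b} (y , z , y∈S , z∈Ss , a≡y+z) b∈Ts x≡a+b =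
  y , (λ i → z i + b i) , y∈S , InMinkowski-++ Ss Ts z∈Ss b∈Ts (λ _ → refl) ,
  λ i → trans (x≡a+b i) (trans (cong (_+ b i) (a≡y+z i)) (+-assoc (y i) (z i) (b i)))

module _ {n : ℕ} where

  open import Data.List.Membership.DecPropositional (_≟_ {n}) using (_∈?_)

  sumOver : List (Fin n) → Pt n → ℚ
  sumOver L p = sumℚ (map p L)

  sumOver-++ : ∀ L M p → sumOver (L ++ M) p ≡ sumOver L p + sumOver M p
  sumOver-++ []      M p = sym (+-identityˡ _)
  sumOver-++ (x ∷ L) M p = trans (cong (p x +_) (sumOver-++ L M p)) (sym (+-assoc (p x) _ _))

  sumOver-cong : ∀ L {p q} → (∀ {i} → i ∈ L → p i ≡ q i) → sumOver L p ≡ sumOver L q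
  sumOver-cong []      p≡q = refl
  sumOver-cong (x ∷ L) p≡q = cong₂ _+_ (p≡q (here refl)) (sumOver-cong L (p≡q ∘ there))

  sumOver-*ˡ : ∀ L c p → sumOver L (λ i → c * p i) ≡ c * sumOver L p
  sumOver-*ˡ []      c p = sym (*-zeroʳ c)
  sumOver-*ˡ (x ∷ L) c p = trans (cong (c * p x +_) (sumOver-*ˡ L c p)) (sym (*-distribˡ-+ c (p x) _))

  sumOver-nonneg : ∀ L {p} → (∀ i → 0ℚ ≤ p i) → 0ℚ ≤ sumOver L p
  sumOver-nonneg []      p≥0 = ≤-refl
  sumOver-nonneg (x ∷ L) p≥0 =
    ≤-trans (≤-reflexive (sym (+-identityˡ 0ℚ))) (+-mono-≤ (p≥0 x) (sumOver-nonneg L p≥0))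

  sumOver≤0⇒≡0 : ∀ {L p} → (∀ i → 0ℚ ≤ p i) → sumOver L p ≤ 0ℚ → ∀ {i} → i ∈ L → p i ≡ 0ℚ
  sumOver≤0⇒≡0 {x ∷ L} {p} p≥0 sum≤0 (here refl) = ≤-antisym (begin
    p x                  ≡⟨ sym (+-identityʳ (p x)) ⟩
    p x + 0ℚ             ≤⟨ +-monoʳ-≤ (p x) (sumOver-nonneg L p≥0) ⟩
    p x + sumOver L p    ≤⟨ sum≤0 ⟩
    0ℚ                   ∎) (p≥0 x)
    where open ≤-Reasoning
  sumOver≤0⇒≡0 {x ∷ L} {p} p≥0 sum≤0 (there i∈L) = sumOver≤0⇒≡0 p≥0 (begin
    sumOver L p          ≡⟨ sym (+-identityˡ _) ⟩
    0ℚ + sumOver L p     ≤⟨ +-monoˡ-≤ (sumOver L p) (p≥0 x) ⟩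
    p x + sumOver L p    ≤⟨ sum≤0 ⟩
    0ℚ                   ∎) i∈L
    where open ≤-Reasoning

  e-diag : ∀ (i : Fin n) → e i i ≡ 1ℚ
  e-diag i with i ≟ i
  ... | yes _   = refl
  ... | no i≢i = contradiction refl i≢i

  e-offdiag : ∀ {i j : Fin n} → i ≢ j → e i j ≡ 0ℚ
  e-offdiag {i} {j} i≢j with i ≟ j
  ... | yes i≡j = contradiction i≡j i≢j
  ... | no _    = refl

  sumOver-basis-∉ : ∀ {U} (y : Pt n) {j} → j ∉ U → sumOver U (λ i → y i * e i j) ≡ 0ℚ
  sumOver-basis-∉ {[]}    y j∉U = refl
  sumOver-basis-∉ {u ∷ U} y j∉U = begin
    y u * e u _ + sumOver U _  ≡⟨ cong₂ _+_ (cong (y u *_) (e-offdiag {u} (λ { refl → j∉U (here refl) })))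
                                            (sumOver-basis-∉ y (j∉U ∘ there)) ⟩
    y u * 0ℚ + 0ℚ              ≡⟨ trans (+-identityʳ _) (*-zeroʳ (y u)) ⟩
    0ℚ                         ∎
    where open ≡-Reasoning

  sumOver-basis-∈ : ∀ {U} (y : Pt n) {j} → Unique U → j ∈ U → sumOver U (λ i → y i * e i j) ≡ y j
  sumOver-basis-∈ {u ∷ U} y (u∉U ∷ _) (here refl) = begin
    y u * e u u + sumOver U _  ≡⟨ cong₂ _+_ (cong (y u *_) (e-diag u))
                                            (sumOver-basis-∉ y (λ u∈U → All.lookup u∉U u∈U refl)) ⟩
    y u * 1ℚ + 0ℚ              ≡⟨ trans (+-identityʳ _) (*-identityʳ (y u)) ⟩
    y u                        ∎
    where open ≡-Reasoning
  sumOver-basis-∈ {u ∷ U} y {j} (u∉U ∷ uU) (there j∈U) = begin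
    y u * e u j + sumOver U _  ≡⟨ cong₂ _+_ (cong (y u *_) (e-offdiag {u} {j} (All.lookup u∉U j∈U)))
                                            (sumOver-basis-∈ y uU j∈U) ⟩
    y u * 0ℚ + y j             ≡⟨ trans (cong (_+ y j) (*-zeroʳ (y u))) (+-identityˡ (y j)) ⟩
    y j                        ∎
    where open ≡-Reasoning

  sumOver-basis : ∀ {U} {y : Pt n} → Unique U → (∀ i → i ∉ U → y i ≡ 0ℚ) →
    ∀ j → sumOver U (λ i → y i * e i j) ≡ y j
  sumOver-basis {U} {y} uU supp j with j ∈? U
  ... | yes j∈U = sumOver-basis-∈ y uU j∈U
  ... | no  j∉U = trans (sumOver-basis-∉ y j∉U) (sym (supp j j∉U))

  scaledSimplex⊆hull : ∀ {c} → 0ℚ < c → ∀ {U} {y : Pt n} → Unique U → (∀ i → 0ℚ ≤ y i) →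
    (∀ i → i ∉ U → y i ≡ 0ℚ) → sumOver U y ≤ c →
    InHull (origin ∷ map (λ i → scale c (e i)) U) y
  scaledSimplex⊆hull {c} 0<c {U} {y} uU y≥0 supp ∑y≤c =
    (1ℚ - s) ∷ map w U , lengths , 0≤1-s ∷ All.map⁺ (All.universal w≥0 U) , weights-sum , expansion
    where
    instance
      c-pos = positive 0<c
      c≢0 = pos⇒nonZero c
    w : Pt n
    w i = y i * 1/ c
    s = sumOver U w
    corners = map (λ i → scale c (e i)) U
    lengths : length ((1ℚ - s) ∷ map w U) ≡ length (origin ∷ corners)
    lengths = cong suc (trans (length-map w U) (sym (length-map _ U)))
    w≥0 : ∀ i → 0ℚ ≤ w i
    w≥0 i = *-nonneg (y≥0 i) (<⇒≤ (positive⁻¹ (1/ c) {{1/pos⇒pos c}}))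
    0≤1-s : 0ℚ ≤ 1ℚ - s
    0≤1-s = 0≤q-p (begin
      s                   ≡⟨ trans (sumOver-cong U (λ {i} _ → *-comm (y i) (1/ c))) (sumOver-*ˡ U (1/ c) y) ⟩
      1/ c * sumOver U y  ≤⟨ *-monoˡ-≤-nonNeg (1/ c) {{pos⇒nonNeg (1/ c) {{1/pos⇒pos c}}}} ∑y≤c ⟩
      1/ c * c            ≡⟨ *-inverseˡ c ⟩
      1ℚ                  ∎)
      where open ≤-Reasoning
    weights-sum : 1ℚ - s + s ≡ 1ℚ
    weights-sum = solve 1 (λ s → con 1ℚ :- s :+ s := con 1ℚ) refl s
    corner-weight : ∀ j i → w i * scale c (e i) j ≡ y i * e i j
    corner-weight j i = begin
      y i * 1/ c * (c * e i j)
        ≡⟨ solve 4 (λ Y k c E → Y :* k :* (c :* E) := Y :* E :* (k :* c)) refl (y i) (1/ c) c (e i j) ⟩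
      y i * e i j * (1/ c * c)  ≡⟨ cong (y i * e i j *_) (*-inverseˡ c) ⟩
      y i * e i j * 1ℚ          ≡⟨ *-identityʳ _ ⟩
      y i * e i j               ∎
      where open ≡-Reasoning
    expansion : ∀ j → y j ≡ sumℚ (zipWith (λ w p → w * p j) ((1ℚ - s) ∷ map w U) (origin ∷ corners))
    expansion j = sym (begin
      (1ℚ - s) * 0ℚ + sumℚ (zipWith (λ w p → w * p j) (map w U) corners)
        ≡⟨ cong₂ _+_ (*-zeroʳ (1ℚ - s)) (cong sumℚ (zipWith-map-diagonal (λ w p → w * p j) w _ U)) ⟩
      0ℚ + sumOver U (λ i → w i * scale c (e i) j)
        ≡⟨ +-identityˡ _ ⟩
      sumOver U (λ i → w i * scale c (e i) j)
        ≡⟨ sumOver-cong U (λ {i} _ → corner-weight j i) ⟩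
      sumOver U (λ i → y i * e i j)
        ≡⟨ sumOver-basis uU supp j ⟩
      y j ∎)
      where open ≡-Reasoning

  opaque
    portion : ℚ → List (Fin n) → List (Fin n) → Pt n → Pt n
    portion φ A B p i with i ∈? A | i ∈? B
    ... | yes _ | _     = φ * p i
    ... | no  _ | yes _ = p i
    ... | no  _ | no  _ = 0ℚ

    portion-∈ᴬ : ∀ {φ A B p i} → i ∈ A → portion φ A B p i ≡ φ * p i
    portion-∈ᴬ {A = A} {B} {i = i} i∈A with i ∈? A | i ∈? B
    ... | yes _   | _ = refl
    ... | no i∉A | _ = contradiction i∈A i∉A

    portion-∈ᴮ : ∀ {φ A B p i} → i ∉ A → i ∈ B → portion φ A B p i ≡ p i
    portion-∈ᴮ {A = A} {B} {i = i} i∉A i∈B with i ∈? A | i ∈? B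
    ... | yes i∈A | _       = contradiction i∈A i∉A
    ... | no _    | yes _   = refl
    ... | no _    | no i∉B = contradiction i∈B i∉B

    portion-∉ : ∀ {φ A B p i} → i ∉ A ++ B → portion φ A B p i ≡ 0ℚ
    portion-∉ {A = A} {B} {i = i} i∉A++B with i ∈? A | i ∈? B
    ... | yes i∈A | _       = contradiction (∈-++⁺ˡ i∈A) i∉A++B
    ... | no _    | yes i∈B = contradiction (∈-++⁺ʳ A i∈B) i∉A++B
    ... | no _    | no _    = refl

    portion-nonneg : ∀ {φ A B p} → 0ℚ ≤ φ → (∀ i → 0ℚ ≤ p i) → ∀ i → 0ℚ ≤ portion φ A B p i
    portion-nonneg {A = A} {B} 0≤φ p≥0 i with i ∈? A | i ∈? B
    ... | yes _ | _     = *-nonneg 0≤φ (p≥0 i)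
    ... | no  _ | yes _ = p≥0 i
    ... | no  _ | no  _ = ≤-refl

    portion-split : ∀ φ A B C {p : Pt n} → Disjoint B C → (∀ i → i ∉ A ++ (B ++ C) → p i ≡ 0ℚ) →
      ∀ i → p i ≡ portion φ A B p i + portion (1ℚ - φ) A C p i
    portion-split φ A B C {p} B#C supp i with i ∈? A | i ∈? B | i ∈? C
    ... | yes _   | _       | _       = solve 2 (λ f x → x := f :* x :+ (con 1ℚ :- f) :* x) refl φ (p i)
    ... | no _    | yes i∈B | yes i∈C = contradiction (i∈B , i∈C) B#C
    ... | no _    | yes _   | no _    = sym (+-identityʳ (p i))
    ... | no _    | no _    | yes _   = sym (+-identityˡ (p i))
    ... | no i∉A  | no i∉B  | no i∉C  = supp i (∉-++⁺ A i∉A (∉-++⁺ B i∉B i∉C))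

  module _ (φ : ℚ) (A B : List (Fin n)) (p : Pt n) where

    sumOver-portionᴬ : sumOver A (portion φ A B p) ≡ φ * sumOver A p
    sumOver-portionᴬ = trans (sumOver-cong A portion-∈ᴬ) (sumOver-*ˡ A φ p)

    sumOver-portion : Disjoint A B → sumOver (A ++ B) (portion φ A B p) ≡ φ * sumOver A p + sumOver B p
    sumOver-portion A#B = trans (sumOver-++ A B _)
      (cong₂ _+_ sumOver-portionᴬ (sumOver-cong B (λ i∈B → portion-∈ᴮ (λ i∈A → A#B (i∈A , i∈B)) i∈B)))

  Constraint : Pt n → VInfo n → Set
  Constraint p v = sumOver (VInfo.down v) p ≤ ℕtoℚ (length (VInfo.down v))

  downs-⊆ : ∀ {vs : List (VInfo n)} {D D′} → D ⊆ D′ →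
    All (λ v → VInfo.down v ⊆ D) vs → All (λ v → VInfo.down v ⊆ D′) vs
  downs-⊆ {D = D} {D′} D⊆D′ =
    All.map {P = λ v → VInfo.down v ⊆ D} {Q = λ v → VInfo.down v ⊆ D′} (λ down⊆D → ⊆-trans down⊆D D⊆D′)

  mutual
    down⊆flat : ∀ anc (t : Arbor n) → All (λ v → VInfo.down v ⊆ flat t) (verts anc t)
    down⊆flat anc (node l ts) = ⊆-refl ∷ downs-⊆ (xs⊆ys++xs _ l) (down⊆flatF (anc ++ l) ts)

    down⊆flatF : ∀ anc (ts : List (Arbor n)) → All (λ v → VInfo.down v ⊆ flatF ts) (vertsF anc ts)
    down⊆flatF anc []       = []
    down⊆flatF anc (t ∷ ts) =
      All.++⁺ (downs-⊆ (xs⊆xs++ys _ _) (down⊆flat anc t))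
              (downs-⊆ (xs⊆ys++xs _ (flat t)) (down⊆flatF anc ts))

  constraints-transfer : ∀ {vs D} {p q : Pt n} → All (λ v → VInfo.down v ⊆ D) vs →
    (∀ {i} → i ∈ D → p i ≡ q i) → All (Constraint p) vs → All (Constraint q) vs
  constraints-transfer []             p≡q []       = []
  constraints-transfer (down⊆D ∷ sub) p≡q (c ∷ cs) =
    ≤-trans (≤-reflexive (sumOver-cong _ (λ i∈ → sym (p≡q (down⊆D i∈))))) c ∷ constraints-transfer sub p≡q cs

  flat-constraint : ∀ anc t {p : Pt n} → All (Constraint p) (verts anc t) →
    sumOver (flat t) p ≤ ℕtoℚ (length (flat t))
  flat-constraint anc (node l ts) (c ∷ _) = c

  flatF-constraint : ∀ anc ts {p : Pt n} → All (Constraint p) (vertsF anc ts) →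
    sumOver (flatF ts) p ≤ ℕtoℚ (length (flatF ts))
  flatF-constraint anc []       _  = ≤-refl
  flatF-constraint anc (t ∷ ts) {p} cs = begin
    sumOver (flat t ++ flatF ts) p
      ≡⟨ sumOver-++ (flat t) (flatF ts) p ⟩
    sumOver (flat t) p + sumOver (flatF ts) p
      ≤⟨ +-mono-≤ (flat-constraint anc t (All.++⁻ˡ (verts anc t) cs))
                  (flatF-constraint anc ts (All.++⁻ʳ (verts anc t) cs)) ⟩
    ℕtoℚ (length (flat t)) + ℕtoℚ (length (flatF ts))
      ≡⟨ sym (ℕtoℚ-length-++ (flat t) (flatF ts)) ⟩
    ℕtoℚ (length (flat t ++ flatF ts)) ∎
    where open ≤-Reasoning

  -- p is still to be handed out to the vertices vs of a subtree or forest with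
  -- labels D, below ancestors with labels A.
  record Feasible (A D : List (Fin n)) (vs : List (VInfo n)) (p : Pt n) : Set where
    field
      nonneg      : ∀ i → 0ℚ ≤ p i
      support     : ∀ i → i ∉ A ++ D → p i ≡ 0ℚ
      constraints : All (Constraint p) vs
      mass        : sumOver (A ++ D) p ≤ ℕtoℚ (length D)

  portion-feasible : ∀ {φ A B vs p} → 0ℚ ≤ φ → Disjoint A B → All (λ v → VInfo.down v ⊆ B) vs →
    (∀ i → 0ℚ ≤ p i) → All (Constraint p) vs → φ * sumOver A p + sumOver B p ≤ ℕtoℚ (length B) →
    Feasible A B vs (portion φ A B p)
  portion-feasible {φ} {A} {B} {p = p} 0≤φ A#B down⊆B p≥0 cs room = record
    { nonneg      = portion-nonneg 0≤φ p≥0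
    ; support     = λ _ → portion-∉
    ; constraints =
        constraints-transfer down⊆B (λ i∈B → sym (portion-∈ᴮ (λ i∈A → A#B (i∈A , i∈B)) i∈B)) cs
    ; mass        = ≤-trans (≤-reflexive (sumOver-portion φ A B p A#B)) room
    }

  Feasible-[]⇒≡0 : ∀ {A p} → Feasible A [] [] p → ∀ i → p i ≡ 0ℚ
  Feasible-[]⇒≡0 {A} fp i with i ∈? (A ++ [])
  ... | yes i∈ = sumOver≤0⇒≡0 (Feasible.nonneg fp) (Feasible.mass fp) i∈
  ... | no  i∉ = Feasible.support fp i i∉

  peel-root : ∀ anc l ts {p} → Unique ((anc ++ l) ++ flatF ts) → l ≢ [] →
    Feasible anc (l ++ flatF ts) (verts anc (node l ts)) p →
    Σ (Pt n) λ y → Σ (Pt n) λ q →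
      InU (vinfo l (l ++ flatF ts) (anc ++ l)) y ×
      Feasible (anc ++ l) (flatF ts) (vertsF (anc ++ l) ts) q × (∀ i → p i ≡ y i + q i)
  peel-root anc l ts {p} u l≢[] fp with Unique-++⁻ (anc ++ l) u
  ... | uA , _ , A#F = y , q , y∈U , q-feasible , portion-split φ A [] F (λ ()) support′
    where
    open Feasible fp
    A = anc ++ l
    F = flatF ts
    below = All.tail constraints
    M = sumOver A p
    total : M + (0ℚ + sumOver F p) ≤ ℕtoℚ (length l) + ℕtoℚ (length F)
    total = begin
      M + (0ℚ + sumOver F p)            ≡⟨ cong (M +_) (+-identityˡ _) ⟩
      M + sumOver F p                   ≡⟨ sym (sumOver-++ A F p) ⟩
      sumOver (A ++ F) p                ≡⟨ cong (λ L → sumOver L p) (++-assoc anc l F) ⟩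
      sumOver (anc ++ (l ++ F)) p       ≤⟨ mass ⟩
      ℕtoℚ (length (l ++ F))            ≡⟨ ℕtoℚ-length-++ l F ⟩
      ℕtoℚ (length l) + ℕtoℚ (length F) ∎
      where open ≤-Reasoning
    open MassSplit (split-mass {M = M} (0≤ℕtoℚ (length l)) (flatF-constraint A ts below) total)
    y = portion φ A [] p
    q = portion (1ℚ - φ) A F p
    y∈U : InU (vinfo l (l ++ F) A) y
    y∈U = scaledSimplex⊆hull (0<ℕtoℚ-length l≢[]) uA (portion-nonneg 0≤φ nonneg)
            (λ i i∉A → portion-∉ (∉-++⁺ A i∉A λ ()))
            (≤-trans (≤-reflexive (trans (sumOver-portionᴬ φ A [] p) (sym (+-identityʳ _)))) first-fits)
    q-feasible : Feasible A F (vertsF A ts) q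
    q-feasible = portion-feasible (0≤q-p φ≤1) A#F (down⊆flatF A ts) nonneg below second-fits
    support′ : ∀ i → i ∉ A ++ ([] ++ F) → p i ≡ 0ℚ
    support′ = subst (λ L → ∀ i → i ∉ L → p i ≡ 0ℚ) (sym (++-assoc anc l F)) support

  split-forest : ∀ A c rest {p} → Unique (A ++ (flat c ++ flatF rest)) →
    Feasible A (flat c ++ flatF rest) (verts A c ++ vertsF A rest) p →
    Σ (Pt n) λ z → Σ (Pt n) λ r →
      Feasible A (flat c) (verts A c) z × Feasible A (flatF rest) (vertsF A rest) r ×
      (∀ i → p i ≡ z i + r i)
  split-forest A c rest {p} u fp with Unique-++⁻ A u
  ... | _ , uCR , A#CR with Unique-++⁻ (flat c) uCR
  ...   | _ , _ , C#R = z , r , z-feasible , r-feasible , portion-split φ A C R C#R support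
    where
    open Feasible fp
    C = flat c
    R = flatF rest
    on-c = All.++⁻ˡ (verts A c) constraints
    on-rest = All.++⁻ʳ (verts A c) constraints
    M = sumOver A p
    total : M + (sumOver C p + sumOver R p) ≤ ℕtoℚ (length C) + ℕtoℚ (length R)
    total = begin
      M + (sumOver C p + sumOver R p)   ≡⟨ cong (M +_) (sym (sumOver-++ C R p)) ⟩
      M + sumOver (C ++ R) p            ≡⟨ sym (sumOver-++ A (C ++ R) p) ⟩
      sumOver (A ++ (C ++ R)) p         ≤⟨ mass ⟩
      ℕtoℚ (length (C ++ R))            ≡⟨ ℕtoℚ-length-++ C R ⟩
      ℕtoℚ (length C) + ℕtoℚ (length R) ∎
      where open ≤-Reasoning
    open MassSplit
      (split-mass {M = M} (flat-constraint A c on-c) (flatF-constraint A rest on-rest) total)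
    z = portion φ A C p
    r = portion (1ℚ - φ) A R p
    z-feasible : Feasible A C (verts A c) z
    z-feasible = portion-feasible 0≤φ (λ (a , c) → A#CR (a , ∈-++⁺ˡ c))
                   (down⊆flat A c) nonneg on-c first-fits
    r-feasible : Feasible A R (vertsF A rest) r
    r-feasible = portion-feasible (0≤q-p φ≤1) (λ (a , r) → A#CR (a , ∈-++⁺ʳ C r))
                   (down⊆flatF A rest) nonneg on-rest second-fits

  mutual
    tree-feasible⇒InMinkowski : ∀ anc t {p} → Unique (anc ++ flat t) →
      All (λ v → VInfo.lab v ≢ []) (verts anc t) → Feasible anc (flat t) (verts anc t) p → InMinkowski (map InU (verts anc t)) p
    tree-feasible⇒InMinkowski anc (node l ts) u (l≢[] ∷ nonempty) fp =
      let (y , q , y∈U , q-feasible , p≡y+q) = peel-root anc l ts u′ l≢[] fp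
      in  y , q , y∈U , forest-feasible⇒InMinkowski (anc ++ l) ts u′ nonempty q-feasible , p≡y+q
      where
      u′ = subst Unique (sym (++-assoc anc l (flatF ts))) u

    forest-feasible⇒InMinkowski : ∀ A ts {p} → Unique (A ++ flatF ts) →
      All (λ v → VInfo.lab v ≢ []) (vertsF A ts) → Feasible A (flatF ts) (vertsF A ts) p → InMinkowski (map InU (vertsF A ts)) p
    forest-feasible⇒InMinkowski A []         _ _        fp = Feasible-[]⇒≡0 fp
    forest-feasible⇒InMinkowski A (c ∷ rest) {p} u nonempty fp =
      let (z , r , z-feasible , r-feasible , p≡z+r) = split-forest A c rest u fp
          (uC , uR) = Unique-++-++⁻ A (flat c) u
      in  subst (λ Ss → InMinkowski Ss p) (sym (map-++ InU (verts A c) (vertsF A rest)))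
            (InMinkowski-++ _ _
              (tree-feasible⇒InMinkowski A c uC (All.++⁻ˡ (verts A c) nonempty) z-feasible)
              (forest-feasible⇒InMinkowski A rest uR (All.++⁻ʳ (verts A c) nonempty) r-feasible)
              p≡z+r)

InQ⇒InM : ∀ {n} (t : Arbor n) → IsArbor t → ∀ {x} → InQ t x → InM t x
InQ⇒InM {n} t (flat↭allFin , nonempty) (x≥0 , constraints) =
  tree-feasible⇒InMinkowski [] t labels-unique nonempty record
  { nonneg      = x≥0
  ; support     = λ i i∉ → contradiction (∈-resp-↭ (↭-sym flat↭allFin) (∈-allFin i)) i∉
  ; constraints = constraints
  ; mass        = flat-constraint [] t constraints
  }
  where
  labels-unique : Unique (flat t)
  labels-unique =
    Permutation.Unique-resp-↭ (setoid (Fin n)) (↭⇒↭ₛ (↭-sym flat↭allFin)) (Unique.allFin⁺ n)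

lemma1p7 : (n : ℕ) (t : Arbor n) → IsArbor t →
    (x : Pt n) → IsVertexQ t x → InM t x
lemma1p7 n t arbor x (x∈Q , _) = InQ⇒InM t arbor x∈Q
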